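{- For all integers $j\ge2$ and $k\ge 7j^3$ such that $k+j$ is even, for all $x\in\{ -1,1\}^k$, \[\textsf{WMON}_{k,j}(x)=\textsf{sign}\left(\sum_{i=1}^k\widehat{\textsf{WMON}_{k,j}}(\{i\})\,x_i\right).\]
   Context: $\textsf{sign}(z)=1$ if $z>0$ and $0$ otherwise. $\textsf{WMON}_{k,j}(x_1,\dots,x_k)=\textsf{sign}(j\cdot x_1+\sum_{i=2}^kx_i)$. For $f:\{ -1,1\}^k\to\{0,1\}$ and $i\in[k]$, $\widehat f(\{i\})=\mathbb{E}_{x\sim\mathrm{Unif}(\{ -1,1\}^k)}[f(x)x_i]$. -}

module Defs where

open import Data.Nat as ℕ using (ℕ; zero; suc; _^_)
open import Data.Nat.Properties using (m^n≢0)
open import Data.Integer as ℤ using (ℤ; +_; -[1+_])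
open import Data.Rational as ℚ using (ℚ; 0ℚ; _/_)
open import Data.Rational.Properties using (_<?_)
open import Data.Bool using (Bool; true; false)
open import Data.Fin using (Fin)
import Data.Fin as Fin
open import Data.List using (List; []; _∷_; map; concatMap; foldr)
open import Data.Vec.Functional using (Vector) renaming (_∷_ to _∷ᵛ_)
open import Relation.Nullary.Decidable using (does)
open import Data.Bool using (if_then_else_)

-- A point of {-1,1}^k is a function Fin k → Bool; true ↦ 1, false ↦ -1.
-- Coordinate x_1 is index Fin.zero, x_i is index i-1.
Cube : ℕ → Set
Cube k = Fin k → Bool

val : Bool → ℚ
val true  = ℚ.1ℚ
val false = ℚ.-_ ℚ.1ℚ

sign : ℚ → ℕ
sign z = if does (0ℚ <? z) then 1 else 0

sumℚ : List ℚ → ℚ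
sumℚ = foldr ℚ._+_ 0ℚ

sumFin : (k : ℕ) → (Fin k → ℚ) → ℚ
sumFin zero    f = 0ℚ
sumFin (suc k) f = f Fin.zero ℚ.+ sumFin k (λ i → f (Fin.suc i))

allPoints : (k : ℕ) → List (Cube k)
allPoints zero    = (λ ()) ∷ []
allPoints (suc k) = concatMap (λ b → map (λ x → b ∷ᵛ x) (allPoints k)) (true ∷ false ∷ [])

WMON : (k j : ℕ) → Cube k → ℕ
WMON zero    j x = sign 0ℚ
WMON (suc k) j x =
  sign ((((+ j) / 1) ℚ.* val (x Fin.zero)) ℚ.+ sumFin k (λ i → val (x (Fin.suc i))))

ℕtoℚ : ℕ → ℚ
ℕtoℚ n = (+ n) / 1

fourier1 : (k : ℕ) → (Cube k → ℕ) → Fin k → ℚ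
fourier1 k f i =
  ((+ 1) / (2 ^ k)) {{m^n≢0 2 k}} ℚ.* sumℚ (map (λ x → ℕtoℚ (f x) ℚ.* val (x i)) (allPoints k))

module Submission where

-- Let m = k - 2 = 2p + j and let t be the number of coordinates x₂, …, x_k equal to 1. Then
-- j x₁ + Σ_{i≥2} x_i is 2t - (2p + 1) if x₁ = 1 and 2t - (2(j + p) + 1) if x₁ = -1, an odd integer,
-- so WMON is the threshold function [t > p], resp. [t > j + p]. Counting points by weight,
-- 2^k times the Fourier coefficients are Σ_{r<j} (C(m, p + r) + C(m, p + 1 + r)) for {1} and
-- C(m, p) + C(m, j + p) = 2 C(m, p) for every {i}, i ≥ 2. As p is of order j³, each C(m, r) with
-- p ≤ r ≤ j + p lies within the factor ((p + j)/(p + 1))^j < (j + 1)/j of C(m, p), so the first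
-- coefficient differs from j times the others by less than one of them. The Fourier linear form is
-- thus 2 C(m, p) (j x₁ + Σ_{i≥2} x_i) plus a perturbation of absolute value below 2 C(m, p), and as
-- j x₁ + Σ_{i≥2} x_i is a nonzero integer the two signs agree.

open import Defs

module Binomial where

  open import Data.Nat using (ℕ; zero; suc; pred; _≤_; _<_; _*_; _+_; _∸_; _^_; z≤n; s≤s; NonZero; >-nonZero)
  open import Data.Nat.Properties
  open import Data.Nat.Combinatorics using (_C_; nCk+nC[k+1]≡[n+1]C[k+1]; nC1≡n; nCk≡nC[n∸k])
  open import Data.Nat.Tactic.RingSolver using (solve-∀)
  open import Data.Product using (_×_; _,_; proj₁; proj₂)
  open import Algebra.Properties.CommutativeSemigroup *-commutativeSemigroup
    using (xy∙z≈xz∙y; xy∙z≈x∙zy; x∙yz≈xz∙y; x∙yz≈y∙xz; xy∙z≈y∙xz)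
  open import Relation.Binary.PropositionalEquality

  [k+1]*[n+1]C[k+1]≡[n+1]*nCk : ∀ n k → suc k * (suc n C suc k) ≡ suc n * (n C k)
  [k+1]*[n+1]C[k+1]≡[n+1]*nCk zero    zero    = refl
  [k+1]*[n+1]C[k+1]≡[n+1]*nCk zero    (suc k) = *-zeroʳ (suc (suc k))
  [k+1]*[n+1]C[k+1]≡[n+1]*nCk (suc n) zero    =
    trans (*-identityˡ _) (trans (nC1≡n (suc (suc n))) (sym (*-identityʳ _)))
  [k+1]*[n+1]C[k+1]≡[n+1]*nCk (suc n) (suc k) = begin
    suc (suc k) * (suc (suc n) C suc (suc k))
      ≡⟨ cong (suc (suc k) *_) (sym (nCk+nC[k+1]≡[n+1]C[k+1] (suc n) (suc k))) ⟩
    suc (suc k) * (suc n C suc k + suc n C suc (suc k))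
      ≡⟨ regroup (suc k) (suc n C suc k) (suc n C suc (suc k)) ⟩
    suc k * (suc n C suc k) + suc (suc k) * (suc n C suc (suc k)) + suc n C suc k
      ≡⟨ cong₂ (λ x y → x + y + suc n C suc k) ([k+1]*[n+1]C[k+1]≡[n+1]*nCk n k) ([k+1]*[n+1]C[k+1]≡[n+1]*nCk n (suc k)) ⟩
    suc n * (n C k) + suc n * (n C suc k) + suc n C suc k
      ≡⟨ cong (_+ suc n C suc k) (sym (*-distribˡ-+ (suc n) (n C k) (n C suc k))) ⟩
    suc n * (n C k + n C suc k) + suc n C suc k
      ≡⟨ cong (λ x → suc n * x + suc n C suc k) (nCk+nC[k+1]≡[n+1]C[k+1] n k) ⟩
    suc n * (suc n C suc k) + suc n C suc k
      ≡⟨ +-comm (suc n * (suc n C suc k)) _ ⟩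
    suc (suc n) * (suc n C suc k)
      ∎
    where
    open ≡-Reasoning
    regroup : ∀ k x y → (1 + k) * (x + y) ≡ k * x + (1 + k) * y + x
    regroup = solve-∀

  [k+1]*nC[k+1]≡[n∸k]*nCk : ∀ n k → suc k * (n C suc k) ≡ (n ∸ k) * (n C k)
  [k+1]*nC[k+1]≡[n∸k]*nCk n k = begin
    suc k * (n C suc k)
      ≡⟨ sym (m+n∸m≡n (suc k * (n C k)) _) ⟩
    suc k * (n C k) + suc k * (n C suc k) ∸ suc k * (n C k)
      ≡⟨ cong (_∸ suc k * (n C k)) (sym (*-distribˡ-+ (suc k) (n C k) (n C suc k))) ⟩
    suc k * (n C k + n C suc k) ∸ suc k * (n C k)
      ≡⟨ cong (λ x → suc k * x ∸ suc k * (n C k)) (nCk+nC[k+1]≡[n+1]C[k+1] n k) ⟩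
    suc k * (suc n C suc k) ∸ suc k * (n C k)
      ≡⟨ cong (_∸ suc k * (n C k)) ([k+1]*[n+1]C[k+1]≡[n+1]*nCk n k) ⟩
    suc n * (n C k) ∸ suc k * (n C k)
      ≡⟨ sym (*-distribʳ-∸ (n C k) (suc n) (suc k)) ⟩
    (n ∸ k) * (n C k)
      ∎
    where open ≡-Reasoning

  nCk>0 : ∀ {n k} → k ≤ n → 0 < n C k
  nCk>0 {n}     {zero}  _         = s≤s z≤n
  nCk>0 {suc n} {suc k} (s≤s k≤n) =
    subst (0 <_) (nCk+nC[k+1]≡[n+1]C[k+1] n k) (≤-trans (nCk>0 k≤n) (m≤m+n _ _))

  nC[k+1]*b≤nCk*a : ∀ {n k a b} → n ∸ k ≤ a → b ≤ suc k → (n C suc k) * b ≤ (n C k) * a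
  nC[k+1]*b≤nCk*a {n} {k} {a} {b} n∸k≤a b≤1+k = begin
    (n C suc k) * b      ≤⟨ *-monoʳ-≤ (n C suc k) b≤1+k ⟩
    (n C suc k) * suc k  ≡⟨ *-comm (n C suc k) (suc k) ⟩
    suc k * (n C suc k)  ≡⟨ [k+1]*nC[k+1]≡[n∸k]*nCk n k ⟩
    (n ∸ k) * (n C k)    ≤⟨ *-monoˡ-≤ (n C k) n∸k≤a ⟩
    a * (n C k)          ≡⟨ *-comm a (n C k) ⟩
    (n C k) * a          ∎
    where open ≤-Reasoning

  nCk*b≤nC[k+1]*a : ∀ {n k a b} → b ≤ n ∸ k → suc k ≤ a → (n C k) * b ≤ (n C suc k) * a
  nCk*b≤nC[k+1]*a {n} {k} {a} {b} b≤n∸k 1+k≤a = begin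
    (n C k) * b          ≤⟨ *-monoʳ-≤ (n C k) b≤n∸k ⟩
    (n C k) * (n ∸ k)    ≡⟨ *-comm (n C k) (n ∸ k) ⟩
    (n ∸ k) * (n C k)    ≡⟨ sym ([k+1]*nC[k+1]≡[n∸k]*nCk n k) ⟩
    suc k * (n C suc k)  ≤⟨ *-monoˡ-≤ (n C suc k) 1+k≤a ⟩
    a * (n C suc k)      ≡⟨ *-comm a (n C suc k) ⟩
    (n C suc k) * a      ∎
    where open ≤-Reasoning

  sumBelow : ℕ → (ℕ → ℕ) → ℕ
  sumBelow zero    f = 0
  sumBelow (suc L) f = sumBelow L f + f L

  sumBelow-*-≤ : ∀ L (f : ℕ → ℕ) {α γ} → (∀ e → e < L → f e * α ≤ γ) → sumBelow L f * α ≤ L * γ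
  sumBelow-*-≤ zero    f bound = z≤n
  sumBelow-*-≤ (suc L) f {α} {γ} bound = begin
    (sumBelow L f + f L) * α       ≡⟨ *-distribʳ-+ α (sumBelow L f) (f L) ⟩
    sumBelow L f * α + f L * α     ≤⟨ +-mono-≤ (sumBelow-*-≤ L f (λ e e<L → bound e (m<n⇒m<1+n e<L))) (bound L ≤-refl) ⟩
    L * γ + γ                      ≡⟨ +-comm (L * γ) γ ⟩
    suc L * γ                      ∎
    where open ≤-Reasoning

  sumBelow-*-≥ : ∀ L (f : ℕ → ℕ) {α γ} → (∀ e → e < L → γ ≤ f e * α) → L * γ ≤ sumBelow L f * α
  sumBelow-*-≥ zero    f bound = z≤n
  sumBelow-*-≥ (suc L) f {α} {γ} bound = begin
    suc L * γ                      ≡⟨ +-comm γ (L * γ) ⟩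
    L * γ + γ                      ≤⟨ +-mono-≤ (sumBelow-*-≥ L f (λ e e<L → bound e (m<n⇒m<1+n e<L))) (bound L ≤-refl) ⟩
    sumBelow L f * α + f L * α     ≡⟨ *-distribʳ-+ α (sumBelow L f) (f L) ⟨
    (sumBelow L f + f L) * α       ∎
    where open ≤-Reasoning

  f[d]*b^d≤f[0]*a^d : ∀ (f : ℕ → ℕ) {a b} d → (∀ e → e < d → f (suc e) * b ≤ f e * a) →
                      f d * b ^ d ≤ f 0 * a ^ d
  f[d]*b^d≤f[0]*a^d f         zero    step = ≤-refl
  f[d]*b^d≤f[0]*a^d f {a} {b} (suc d) step = begin
    f (suc d) * (b * b ^ d)  ≡⟨ *-assoc (f (suc d)) b (b ^ d) ⟨
    f (suc d) * b * b ^ d    ≤⟨ *-monoˡ-≤ (b ^ d) (step d ≤-refl) ⟩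
    f d * a * b ^ d          ≡⟨ xy∙z≈xz∙y (f d) a (b ^ d) ⟩
    f d * b ^ d * a          ≤⟨ *-monoˡ-≤ a (f[d]*b^d≤f[0]*a^d f d (λ e e<d → step e (m<n⇒m<1+n e<d))) ⟩
    f 0 * a ^ d * a          ≡⟨ xy∙z≈x∙zy (f 0) (a ^ d) a ⟩
    f 0 * (a * a ^ d)        ∎
    where open ≤-Reasoning

  f[0]*b^d≤f[d]*a^d : ∀ (f : ℕ → ℕ) {a b} d → (∀ e → e < d → f e * b ≤ f (suc e) * a) →
                      f 0 * b ^ d ≤ f d * a ^ d
  f[0]*b^d≤f[d]*a^d f         zero    step = ≤-refl
  f[0]*b^d≤f[d]*a^d f {a} {b} (suc d) step = begin
    f 0 * (b * b ^ d)        ≡⟨ x∙yz≈xz∙y (f 0) b (b ^ d) ⟩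
    f 0 * b ^ d * b          ≤⟨ *-monoˡ-≤ b (f[0]*b^d≤f[d]*a^d f d (λ e e<d → step e (m<n⇒m<1+n e<d))) ⟩
    f d * a ^ d * b          ≡⟨ xy∙z≈xz∙y (f d) (a ^ d) b ⟩
    f d * b * a ^ d          ≤⟨ *-monoˡ-≤ (a ^ d) (step d ≤-refl) ⟩
    f (suc d) * a * a ^ d    ≡⟨ *-assoc (f (suc d)) a (a ^ d) ⟩
    f (suc d) * (a * a ^ d)  ∎
    where open ≤-Reasoning

  x*b^d≤y*a^d⇒x*b^e≤y*a^e : ∀ x y {a b d e} → b ≤ a → d ≤ e → x * b ^ d ≤ y * a ^ d → x * b ^ e ≤ y * a ^ e
  x*b^d≤y*a^d⇒x*b^e≤y*a^e x y {a} {b} {d} b≤a d≤e le with m≤n⇒∃[o]m+o≡n d≤e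
  ... | o , refl = begin
    x * b ^ (d + o)        ≡⟨ cong (x *_) (^-distribˡ-+-* b d o) ⟩
    x * (b ^ d * b ^ o)    ≡⟨ *-assoc x (b ^ d) (b ^ o) ⟨
    x * b ^ d * b ^ o      ≤⟨ *-mono-≤ le (^-monoˡ-≤ o b≤a) ⟩
    y * a ^ d * a ^ o      ≡⟨ *-assoc y (a ^ d) (a ^ o) ⟩
    y * (a ^ d * a ^ o)    ≡⟨ cong (y *_) (^-distribˡ-+-* a d o) ⟨
    y * a ^ (d + o)        ∎
    where open ≤-Reasoning

  [b+e]^[1+n]≤b^[1+n]+[1+n]*e*[b+e]^n : ∀ b e n → (b + e) ^ suc n ≤ b ^ suc n + suc n * e * (b + e) ^ n
  [b+e]^[1+n]≤b^[1+n]+[1+n]*e*[b+e]^n b e zero    = ≤-reflexive (identity b e)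
    where
    identity : ∀ b e → (b + e) * 1 ≡ b * 1 + 1 * e * 1
    identity = solve-∀
  [b+e]^[1+n]≤b^[1+n]+[1+n]*e*[b+e]^n b e (suc n) = begin
    (b + e) * A                              ≤⟨ *-monoʳ-≤ (b + e) ([b+e]^[1+n]≤b^[1+n]+[1+n]*e*[b+e]^n b e n) ⟩
    (b + e) * (Q + suc n * e * P)            ≡⟨ expand b e Q (suc n) P ⟩
    b * Q + (e * Q + suc n * e * ((b + e) * P))
      ≤⟨ +-monoʳ-≤ (b * Q) (+-monoˡ-≤ _ (*-monoʳ-≤ e (^-monoˡ-≤ (suc n) (m≤m+n b e)))) ⟩
    b * Q + (e * A + suc n * e * A)          ≡⟨ collect b e Q (suc n) A ⟩
    b * Q + suc (suc n) * e * A              ∎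
    where
    open ≤-Reasoning
    P = (b + e) ^ n
    A = (b + e) ^ suc n
    Q = b ^ suc n
    expand : ∀ b e Q N P → (b + e) * (Q + N * e * P) ≡ b * Q + (e * Q + N * e * ((b + e) * P))
    expand = solve-∀
    collect : ∀ b e Q N A → b * Q + (e * A + N * e * A) ≡ b * Q + (1 + N) * e * A
    collect = solve-∀

  w*[b+e]^[1+n]<[1+w]*b^[1+n] : ∀ w b e n → suc w * suc n * e < b + e →
                                 w * (b + e) ^ suc n < suc w * b ^ suc n
  w*[b+e]^[1+n]<[1+w]*b^[1+n] w b e n small = +-cancelˡ-< A _ _ (begin-strict
    A + w * A                           ≤⟨ *-monoʳ-≤ (suc w) ([b+e]^[1+n]≤b^[1+n]+[1+n]*e*[b+e]^n b e n) ⟩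
    suc w * (Q + suc n * e * P)         ≡⟨ expand (suc w) Q (suc n) e P ⟩
    suc w * Q + suc w * suc n * e * P   <⟨ +-monoʳ-< (suc w * Q) (*-monoˡ-< P small) ⟩
    suc w * Q + A                       ≡⟨ +-comm (suc w * Q) A ⟩
    A + suc w * Q                       ∎)
    where
    open ≤-Reasoning
    P = (b + e) ^ n
    A = (b + e) ^ suc n
    Q = b ^ suc n
    instance
      P≢0 : NonZero P
      P≢0 = m^n≢0 (b + e) n {{>-nonZero (≤-trans (s≤s z≤n) small)}}
    expand : ∀ W Q N e P → W * (Q + N * e * P) ≡ W * Q + W * N * e * P
    expand = solve-∀

  -- binomialTail m q = Σ_{r ≥ q} m C r, the number of points of {0,1}^m with at least q ones.
  binomialTail : ℕ → ℕ → ℕ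
  binomialTail zero    zero    = 1
  binomialTail zero    (suc q) = 0
  binomialTail (suc m) q       = binomialTail m (pred q) + binomialTail m q

  binomialTail≡C+binomialTail : ∀ m q → binomialTail m q ≡ m C q + binomialTail m (suc q)
  binomialTail≡C+binomialTail zero    zero    = refl
  binomialTail≡C+binomialTail zero    (suc q) = refl
  binomialTail≡C+binomialTail (suc m) zero    = begin
    T 0 + T 0              ≡⟨ cong (_+ T 0) (binomialTail≡C+binomialTail m 0) ⟩
    suc (T 1 + T 0)        ≡⟨ cong suc (+-comm (T 1) (T 0)) ⟩
    suc (T 0 + T 1)        ∎
    where
    open ≡-Reasoning
    T = binomialTail m
  binomialTail≡C+binomialTail (suc m) (suc q) = begin
    T q + T (suc q)
      ≡⟨ cong₂ _+_ (binomialTail≡C+binomialTail m q) (binomialTail≡C+binomialTail m (suc q)) ⟩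
    (m C q + T (suc q)) + (m C suc q + T (suc (suc q)))
      ≡⟨ regroup (m C q) (T (suc q)) (m C suc q) (T (suc (suc q))) ⟩
    (m C q + m C suc q) + (T (suc q) + T (suc (suc q)))
      ≡⟨ cong (_+ (T (suc q) + T (suc (suc q)))) (nCk+nC[k+1]≡[n+1]C[k+1] m q) ⟩
    suc m C suc q + (T (suc q) + T (suc (suc q)))
      ∎
    where
    open ≡-Reasoning
    T = binomialTail m
    regroup : ∀ a b c d → (a + b) + (c + d) ≡ (a + c) + (b + d)
    regroup = solve-∀

  binomialTail≡window+binomialTail : ∀ m q L →
    binomialTail m q ≡ sumBelow L (λ e → m C (e + q)) + binomialTail m (L + q)
  binomialTail≡window+binomialTail m q zero    = refl
  binomialTail≡window+binomialTail m q (suc L) = begin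
    binomialTail m q
      ≡⟨ binomialTail≡window+binomialTail m q L ⟩
    S + binomialTail m (L + q)
      ≡⟨ cong (S +_) (binomialTail≡C+binomialTail m (L + q)) ⟩
    S + (m C (L + q) + binomialTail m (suc L + q))
      ≡⟨ +-assoc S _ _ ⟨
    S + m C (L + q) + binomialTail m (suc L + q)
      ∎
    where
    open ≡-Reasoning
    S = sumBelow L (λ e → m C (e + q))

  module CentralBinomials (p j : ℕ) where

    m β a b : ℕ
    m = p + p + j
    β = m C p
    a = p + j
    b = suc p

    m∸p≡a : m ∸ p ≡ a
    m∸p≡a = trans (cong (_∸ p) (+-assoc p p j)) (m+n∸m≡n p a)

    mC[j+p]≡β : m C (j + p) ≡ β
    mC[j+p]≡β = begin
      m C (j + p)          ≡⟨ nCk≡nC[n∸k] (subst (j + p ≤_) (sym m≡p+[j+p]) (m≤n+m (j + p) p)) ⟩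
      m C (m ∸ (j + p))    ≡⟨ cong (λ r → m C (r ∸ (j + p))) m≡p+[j+p] ⟩
      m C (p + (j + p) ∸ (j + p))  ≡⟨ cong (m C_) (m+n∸n≡m p (j + p)) ⟩
      β                    ∎
      where
      open ≡-Reasoning
      p+p+j≡p+[j+p] : ∀ p j → p + p + j ≡ p + (j + p)
      p+p+j≡p+[j+p] = solve-∀
      m≡p+[j+p] : m ≡ p + (j + p)
      m≡p+[j+p] = p+p+j≡p+[j+p] p j

    b≤a : 1 ≤ j → b ≤ a
    b≤a 1≤j = subst (_≤ a) (+-comm p 1) (+-monoʳ-≤ p 1≤j)

    mC[1+d+p]*b≤mC[d+p]*a : ∀ d → (m C (suc d + p)) * b ≤ (m C (d + p)) * a
    mC[1+d+p]*b≤mC[d+p]*a d =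
      nC[k+1]*b≤nCk*a (≤-trans (∸-monoʳ-≤ m (m≤n+m p d)) (≤-reflexive m∸p≡a)) (s≤s (m≤n+m p d))

    mC[d+p]*b≤mC[1+d+p]*a : ∀ d → d < j → (m C (d + p)) * b ≤ (m C (suc d + p)) * a
    mC[d+p]*b≤mC[1+d+p]*a d d<j =
      nCk*b≤nC[k+1]*a (m+n≤o⇒m≤o∸n b b+[d+p]≤m) (subst (suc d + p ≤_) (+-comm j p) (+-monoˡ-≤ p d<j))
      where
      shape : ∀ p d → suc p + (d + p) ≡ p + p + suc d
      shape = solve-∀
      b+[d+p]≤m : b + (d + p) ≤ m
      b+[d+p]≤m = subst (_≤ m) (sym (shape p d)) (+-monoʳ-≤ (p + p) d<j)

    central-bounds : 1 ≤ j → ∀ r → p ≤ r → r ≤ j + p →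
                     (m C r) * b ^ j ≤ β * a ^ j × β * b ^ j ≤ (m C r) * a ^ j
    central-bounds 1≤j r p≤r r≤j+p with m≤n⇒∃[o]m+o≡n p≤r
    ... | d , refl = subst (λ r → (m C r) * b ^ j ≤ β * a ^ j × β * b ^ j ≤ (m C r) * a ^ j) (+-comm d p)
                           (upper , lower)
      where
      f : ℕ → ℕ
      f e = m C (e + p)
      d≤j : d ≤ j
      d≤j = +-cancelʳ-≤ p d j (subst (_≤ j + p) (+-comm p d) r≤j+p)
      upper : f d * b ^ j ≤ β * a ^ j
      upper = x*b^d≤y*a^d⇒x*b^e≤y*a^e (f d) β (b≤a 1≤j) d≤j
                (f[d]*b^d≤f[0]*a^d f d (λ e _ → mC[1+d+p]*b≤mC[d+p]*a e))
      lower : β * b ^ j ≤ f d * a ^ j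
      lower = x*b^d≤y*a^d⇒x*b^e≤y*a^e β (f d) (b≤a 1≤j) d≤j
                (f[0]*b^d≤f[d]*a^d f d (λ e e<d → mC[d+p]*b≤mC[1+d+p]*a e (<-≤-trans e<d d≤j)))

    window-bounds : 1 ≤ j → j * a ^ j < suc j * b ^ j → ∀ q → p ≤ q → q ≤ suc p →
                    j * β < sumBelow j (λ e → m C (e + q)) + β × sumBelow j (λ e → m C (e + q)) < j * β + β
    window-bounds 1≤j power q p≤q q≤1+p = lower , upper
      where
      open ≤-Reasoning
      S A B : ℕ
      S = sumBelow j (λ e → m C (e + q))
      A = a ^ j
      B = b ^ j
      instance
        β≢0 : NonZero β
        β≢0 = >-nonZero (nCk>0 (≤-trans (m≤m+n p p) (m≤m+n (p + p) j)))
      term : ∀ e → e < j → (m C (e + q)) * B ≤ β * A × β * B ≤ (m C (e + q)) * A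
      term e e<j = central-bounds 1≤j (e + q) (≤-trans p≤q (m≤n+m q e)) (begin
        e + q       ≤⟨ +-monoʳ-≤ e q≤1+p ⟩
        e + suc p   ≡⟨ +-suc e p ⟩
        suc e + p   ≤⟨ +-monoˡ-≤ p e<j ⟩
        j + p       ∎)
      jA<jB+A : j * A < j * B + A
      jA<jB+A = begin-strict
        j * A       <⟨ power ⟩
        B + j * B   ≤⟨ +-monoˡ-≤ (j * B) (^-monoˡ-≤ j (b≤a 1≤j)) ⟩
        A + j * B   ≡⟨ +-comm A (j * B) ⟩
        j * B + A   ∎
      upper : S < j * β + β
      upper = *-cancelʳ-< B S (j * β + β) (begin-strict
        S * B             ≤⟨ sumBelow-*-≤ j _ (λ e e<j → proj₁ (term e e<j)) ⟩
        j * (β * A)       ≡⟨ x∙yz≈y∙xz j β A ⟩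
        β * (j * A)       <⟨ *-monoʳ-< β power ⟩
        β * (suc j * B)   ≡⟨ y*[[1+x]*z]≡[x*y+y]*z β j B ⟩
        (j * β + β) * B   ∎)
        where
        y*[[1+x]*z]≡[x*y+y]*z : ∀ y x z → y * ((1 + x) * z) ≡ (x * y + y) * z
        y*[[1+x]*z]≡[x*y+y]*z = solve-∀
      lower : j * β < S + β
      lower = *-cancelʳ-< A (j * β) (S + β) (begin-strict
        j * β * A              ≡⟨ xy∙z≈y∙xz j β A ⟩
        β * (j * A)            <⟨ *-monoʳ-< β jA<jB+A ⟩
        β * (j * B + A)        ≡⟨ y*[x*z+w]≡x*[y*z]+y*w β j B A ⟩
        j * (β * B) + β * A    ≤⟨ +-monoˡ-≤ (β * A) (sumBelow-*-≥ j _ (λ e e<j → proj₂ (term e e<j))) ⟩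
        S * A + β * A          ≡⟨ *-distribʳ-+ A S β ⟨
        (S + β) * A            ∎)
        where
        y*[x*z+w]≡x*[y*z]+y*w : ∀ y x z w → y * (x * z + w) ≡ x * (y * z) + y * w
        y*[x*z+w]≡x*[y*z]+y*w = solve-∀

module CubeSums where

  open import Data.Nat as ℕ using (ℕ; zero; suc; pred)
  import Data.Nat.Properties as ℕ
  open import Data.Nat.Combinatorics using (_C_)
  open import Data.Integer using (ℤ; +_; -[1+_]; 0ℤ; 1ℤ; -1ℤ; _+_; _-_; _*_; -_; _⊖_; _<_; _≤_; +<+)
  open import Data.Integer.Properties
  open import Data.Integer.Tactic.RingSolver using (solve-∀)
  open import Algebra.Properties.Semiring.Sum +-*-semiring using (sum)
  open import Data.Bool using (Bool; true; false; if_then_else_)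
  open import Data.Empty using (⊥-elim)
  open import Data.Fin using (zero; suc)
  open import Data.Vec.Functional using (_∷_; head; tail)
  open import Function.Bundles using (_⇔_; mk⇔; Equivalence)
  open import Function.Properties.Equivalence using () renaming (trans to ⇔-trans)
  open import Relation.Binary.PropositionalEquality
  open import Relation.Nullary using (yes; no)
  open import Relation.Nullary.Decidable using (does; does-⇔)
  open Binomial using (binomialTail; binomialTail≡C+binomialTail)

  valℤ : Bool → ℤ
  valℤ true  = 1ℤ
  valℤ false = -1ℤ

  sumCube : (m : ℕ) → (Cube m → ℤ) → ℤ
  sumCube zero    G = G (λ ())
  sumCube (suc m) G = sumCube m (λ z → G (true ∷ z)) + sumCube m (λ z → G (false ∷ z))

  sumCube-cong : ∀ m {G H : Cube m → ℤ} → (∀ y → G y ≡ H y) → sumCube m G ≡ sumCube m H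
  sumCube-cong zero    G≗H = G≗H _
  sumCube-cong (suc m) G≗H =
    cong₂ _+_ (sumCube-cong m (λ z → G≗H (true ∷ z))) (sumCube-cong m (λ z → G≗H (false ∷ z)))

  sumCube-*ʳ : ∀ m (G : Cube m → ℤ) c → sumCube m (λ y → G y * c) ≡ sumCube m G * c
  sumCube-*ʳ zero    G c = refl
  sumCube-*ʳ (suc m) G c =
    trans (cong₂ _+_ (sumCube-*ʳ m (λ z → G (true ∷ z)) c) (sumCube-*ʳ m (λ z → G (false ∷ z)) c))
          (sym (*-distribʳ-+ c (sumCube m (λ z → G (true ∷ z))) (sumCube m (λ z → G (false ∷ z)))))

  weight : ∀ {m} → Cube m → ℕ
  weight {zero}  y = 0
  weight {suc m} y = if head y then suc (weight (tail y)) else weight (tail y)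

  sumCube-weight-*-coordinate : ∀ m (h : ℕ → ℤ) i →
    sumCube (suc m) (λ y → h (weight y) * valℤ (y i)) ≡
    sumCube m (λ z → h (suc (weight z))) - sumCube m (λ z → h (weight z))
  sumCube-weight-*-coordinate m h zero =
    trans (cong₂ _+_ (sumCube-*ʳ m (λ z → h (suc (weight z))) 1ℤ) (sumCube-*ʳ m (λ z → h (weight z)) -1ℤ))
          (x*1+y*-1≡x-y (sumCube m (λ z → h (suc (weight z)))) (sumCube m (λ z → h (weight z))))
    where
    x*1+y*-1≡x-y : ∀ x y → x * 1ℤ + y * -1ℤ ≡ x - y
    x*1+y*-1≡x-y = solve-∀
  sumCube-weight-*-coordinate (suc m) h (suc i) =
    trans (cong₂ _+_ (sumCube-weight-*-coordinate m (λ r → h (suc r)) i) (sumCube-weight-*-coordinate m h i))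
          (telescope (Σ (λ r → h (suc (suc r)))) (Σ (λ r → h (suc r))) (Σ h))
    where
    Σ : (ℕ → ℤ) → ℤ
    Σ g = sumCube m (λ z → g (weight z))
    telescope : ∀ x y z → (x - y) + (y - z) ≡ (x + y) - (y + z)
    telescope = solve-∀

  atLeast : ℕ → ℕ → ℕ
  atLeast q r = if does (q ℕ.≤? r) then 1 else 0

  atLeast-suc : ∀ q r → atLeast q (suc r) ≡ atLeast (pred q) r
  atLeast-suc zero    r = refl
  atLeast-suc (suc q) r =
    cong (λ b → if b then 1 else 0) (does-⇔ (mk⇔ ℕ.≤-pred ℕ.s≤s) (suc q ℕ.≤? suc r) (q ℕ.≤? r))

  sumCube-atLeast : ∀ m q → sumCube m (λ y → + atLeast q (weight y)) ≡ + binomialTail m q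
  sumCube-atLeast zero    zero    = refl
  sumCube-atLeast zero    (suc q) = refl
  sumCube-atLeast (suc m) q = cong₂ _+_
    (trans (sumCube-cong m (λ z → cong +_ (atLeast-suc q (weight z)))) (sumCube-atLeast m (pred q)))
    (sumCube-atLeast m q)

  sum-valℤ+m≡2*weight : ∀ m (z : Cube m) → sum (λ i → valℤ (z i)) + + m ≡ + (2 ℕ.* weight z)
  sum-valℤ+m≡2*weight zero    z = refl
  sum-valℤ+m≡2*weight (suc m) z with z zero
  ... | true  = begin
    (1ℤ + S) + (1ℤ + + m)   ≡⟨ regroup S (+ m) ⟩
    (S + + m) + + 2         ≡⟨ cong (_+ + 2) (sum-valℤ+m≡2*weight m (tail z)) ⟩
    + (2 ℕ.* w ℕ.+ 2)       ≡⟨ cong +_ (trans (ℕ.+-comm (2 ℕ.* w) 2) (sym (ℕ.*-suc 2 w))) ⟩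
    + (2 ℕ.* suc w)         ∎
    where
    open ≡-Reasoning
    S = sum (λ i → valℤ (z (suc i)))
    w = weight (tail z)
    regroup : ∀ s n → (1ℤ + s) + (1ℤ + n) ≡ (s + n) + + 2
    regroup = solve-∀
  ... | false = trans (cancel S (+ m)) (sum-valℤ+m≡2*weight m (tail z))
    where
    S = sum (λ i → valℤ (z (suc i)))
    cancel : ∀ s n → (-1ℤ + s) + (1ℤ + n) ≡ s + n
    cancel = solve-∀

  0<[+m]-[+n]⇔n<m : ∀ m n → 0ℤ < + m - + n ⇔ n ℕ.< m
  0<[+m]-[+n]⇔n<m m n rewrite [+m]-[+n]≡m⊖n m n = mk⇔ to from
    where
    to : 0ℤ < m ⊖ n → n ℕ.< m
    to 0<m⊖n with n ℕ.<? m
    ... | yes n<m = n<m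
    ... | no  n≮m = ⊥-elim (<⇒≱ 0<m⊖n (subst (_≤ 0ℤ) (sym (⊖-≤ (ℕ.≮⇒≥ n≮m))) neg-≤-pos))
    from : n ℕ.< m → 0ℤ < m ⊖ n
    from n<m = subst (0ℤ <_) (sym (⊖-≥ (ℕ.<⇒≤ n<m))) (+<+ (ℕ.m<n⇒0<n∸m n<m))

  0<[2t]-[1+2a]⇔1+a≤t : ∀ t a → 0ℤ < + (2 ℕ.* t) - + suc (2 ℕ.* a) ⇔ suc a ℕ.≤ t
  0<[2t]-[1+2a]⇔1+a≤t t a = ⇔-trans (0<[+m]-[+n]⇔n<m (2 ℕ.* t) (suc (2 ℕ.* a))) halve
    where
    halve : suc (2 ℕ.* a) ℕ.< 2 ℕ.* t ⇔ suc a ℕ.≤ t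
    halve = mk⇔ (λ lt → ℕ.*-cancelˡ-≤ 2 (subst (ℕ._≤ 2 ℕ.* t) (sym (ℕ.*-suc 2 a)) lt))
                (λ le → subst (ℕ._≤ 2 ℕ.* t) (ℕ.*-suc 2 a) (ℕ.*-monoʳ-≤ 2 le))

  [2t]-[1+2a]≢0 : ∀ t a → + (2 ℕ.* t) - + suc (2 ℕ.* a) ≢ 0ℤ
  [2t]-[1+2a]≢0 t a eq = ℕ.even≢odd t a (+-injective (i-j≡0⇒i≡j _ _ eq))

  -- Since w ≠ 0, the term b * w has absolute value at least b, which outweighs x - y ∈ (-b, b).
  0<b*w+[x-y]⇔0<w : ∀ b x y (w : ℤ) → w ≢ 0ℤ → y ℕ.< x ℕ.+ b → x ℕ.< y ℕ.+ b →
                     0ℤ < + b * w + (+ x - + y) ⇔ 0ℤ < w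
  0<b*w+[x-y]⇔0<w b x y (+ zero)  w≢0 _ _ = ⊥-elim (w≢0 refl)
  0<b*w+[x-y]⇔0<w b x y (+ suc n) _ y<x+b _ =
    mk⇔ (λ _ → +<+ (ℕ.s≤s ℕ.z≤n))
        (λ _ → subst (0ℤ <_) (sym form) (Equivalence.from (0<[+m]-[+n]⇔n<m (bw ℕ.+ x) y) y<bw+x))
    where
    open ≡-Reasoning
    bw = b ℕ.* suc n
    form : + b * + suc n + (+ x - + y) ≡ + (bw ℕ.+ x) - + y
    form = begin
      + b * + suc n + (+ x - + y)  ≡⟨ cong (_+ (+ x - + y)) (pos-* b (suc n)) ⟨
      + bw + (+ x - + y)           ≡⟨ +-assoc (+ bw) (+ x) (- + y) ⟨
      + bw + + x - + y             ∎
    y<bw+x : y ℕ.< bw ℕ.+ x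
    y<bw+x = ℕ.<-≤-trans (subst (y ℕ.<_) (ℕ.+-comm x b) y<x+b) (ℕ.+-monoˡ-≤ x (ℕ.m≤m*n b (suc n)))
  0<b*w+[x-y]⇔0<w b x y -[1+ n ] _ _ x<y+b =
    mk⇔ (λ pos → ⊥-elim (ℕ.<-asym (Equivalence.to (0<[+m]-[+n]⇔n<m x (bw ℕ.+ y)) (subst (0ℤ <_) form pos)) x<bw+y))
        (λ ())
    where
    open ≡-Reasoning
    bw = b ℕ.* suc n
    form : + b * -[1+ n ] + (+ x - + y) ≡ + x - + (bw ℕ.+ y)
    form = begin
      + b * -[1+ n ] + (+ x - + y)     ≡⟨ cong (_+ (+ x - + y)) (neg-distribʳ-* (+ b) (+ suc n)) ⟨
      - (+ b * + suc n) + (+ x - + y)  ≡⟨ cong (λ u → - u + (+ x - + y)) (pos-* b (suc n)) ⟨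
      - + bw + (+ x - + y)             ≡⟨ shift (+ bw) (+ x) (+ y) ⟩
      + x - (+ bw + + y)               ∎
      where
      shift : ∀ z x y → - z + (x - y) ≡ x - (z + y)
      shift = solve-∀
    x<bw+y : x ℕ.< bw ℕ.+ y
    x<bw+y = ℕ.<-≤-trans (subst (x ℕ.<_) (ℕ.+-comm y b) x<y+b) (ℕ.+-monoˡ-≤ y (ℕ.m≤m*n b (suc n)))

  sumCube-atLeast-*-coordinate : ∀ m c i →
    sumCube (suc m) (λ z → + atLeast (suc c) (weight z) * valℤ (z i)) ≡ + (m C c)
  sumCube-atLeast-*-coordinate m c i = begin
    sumCube (suc m) (λ z → + atLeast (suc c) (weight z) * valℤ (z i))
      ≡⟨ sumCube-weight-*-coordinate m (λ r → + atLeast (suc c) r) i ⟩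
    sumCube m (λ z → + atLeast (suc c) (suc (weight z))) - sumCube m (λ z → + atLeast (suc c) (weight z))
      ≡⟨ cong₂ _-_ (trans (sumCube-cong m (λ z → cong +_ (atLeast-suc (suc c) (weight z)))) (sumCube-atLeast m c))
                   (sumCube-atLeast m (suc c)) ⟩
    + binomialTail m c - + binomialTail m (suc c)
      ≡⟨ cong (_- + binomialTail m (suc c)) (cong +_ (binomialTail≡C+binomialTail m c)) ⟩
    + (m C c) + + binomialTail m (suc c) - + binomialTail m (suc c)
      ≡⟨ x+y-y≡x (+ (m C c)) (+ binomialTail m (suc c)) ⟩
    + (m C c)
      ∎
    where
    open ≡-Reasoning
    x+y-y≡x : ∀ x y → x + y - y ≡ x
    x+y-y≡x = solve-∀

  linear-sign-stable : ∀ B Y J (v : Bool) S → J ℕ.* B ℕ.< Y ℕ.+ B → Y ℕ.< J ℕ.* B ℕ.+ B →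
    + J * valℤ v + S ≢ 0ℤ → 0ℤ < + Y * valℤ v + + B * S ⇔ 0ℤ < + J * valℤ v + S
  linear-sign-stable B Y J true S lo hi w≢0 =
    subst (λ z → 0ℤ < z ⇔ 0ℤ < + J * 1ℤ + S) (sym form)
          (0<b*w+[x-y]⇔0<w B Y (J ℕ.* B) (+ J * 1ℤ + S) w≢0 lo hi)
    where
    form : + Y * 1ℤ + + B * S ≡ + B * (+ J * 1ℤ + S) + (+ Y - + (J ℕ.* B))
    form = trans (identity (+ Y) (+ B) (+ J) S) (cong (λ c → + B * (+ J * 1ℤ + S) + (+ Y - c)) (sym (pos-* J B)))
      where
      identity : ∀ y b j s → y * 1ℤ + b * s ≡ b * (j * 1ℤ + s) + (y - j * b)
      identity = solve-∀
  linear-sign-stable B Y J false S lo hi w≢0 =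
    subst (λ z → 0ℤ < z ⇔ 0ℤ < + J * -1ℤ + S) (sym form)
          (0<b*w+[x-y]⇔0<w B (J ℕ.* B) Y (+ J * -1ℤ + S) w≢0 hi lo)
    where
    form : + Y * -1ℤ + + B * S ≡ + B * (+ J * -1ℤ + S) + (+ (J ℕ.* B) - + Y)
    form = trans (identity (+ Y) (+ B) (+ J) S) (cong (λ c → + B * (+ J * -1ℤ + S) + (c - + Y)) (sym (pos-* J B)))
      where
      identity : ∀ y b j s → y * -1ℤ + b * s ≡ b * (j * -1ℤ + s) + (j * b - y)
      identity = solve-∀

module RationalSigns where

  open import Data.Nat as ℕ using (ℕ; zero; suc; _^_)
  import Data.Nat.Properties as ℕ
  open import Data.Integer as ℤ using (ℤ; +_)
  import Data.Integer.Properties as ℤ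
  open import Data.Rational using (ℚ; 0ℚ; _/_; mkℚ; _+_; _*_; _<_; *<*; Positive)
  open import Data.Rational.Properties
  open import Data.Nat.Coprimality using (1-coprimeTo) renaming (sym to coprime-sym)
  open import Algebra.Properties.Semiring.Sum ℤ.+-*-semiring using (sum)
  open import Data.Bool using (true; false; if_then_else_)
  open import Data.Fin using (Fin; zero; suc)
  open import Data.List using ([]; _∷_; map; _++_)
  import Data.List.Properties as List
  open import Data.Vec.Functional using () renaming (_∷_ to _∷ᵛ_)
  open import Function.Bundles using (_⇔_; mk⇔)
  open import Relation.Binary.PropositionalEquality
  open import Relation.Nullary.Decidable using (does-⇔)
  open CubeSums using (valℤ; sumCube; atLeast)

  ι : ℤ → ℚ
  ι z = z / 1

  ι≡mkℚ : ∀ z → ι z ≡ mkℚ z 0 (coprime-sym (1-coprimeTo ℤ.∣ z ∣))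
  ι≡mkℚ z = ↥p/↧p≡p (mkℚ z 0 (coprime-sym (1-coprimeTo ℤ.∣ z ∣)))

  ι-+ : ∀ x y → ι (x ℤ.+ y) ≡ ι x + ι y
  ι-+ x y rewrite ι≡mkℚ x | ι≡mkℚ y = cong (_/ 1) (cong₂ ℤ._+_ (sym (ℤ.*-identityʳ x)) (sym (ℤ.*-identityʳ y)))

  ι-* : ∀ x y → ι (x ℤ.* y) ≡ ι x * ι y
  ι-* x y rewrite ι≡mkℚ x | ι≡mkℚ y = refl

  0<ι⇔0< : ∀ z → 0ℚ < ι z ⇔ ℤ.0ℤ ℤ.< z
  0<ι⇔0< z rewrite ι≡mkℚ z = mk⇔
    (λ 0<z → subst (ℤ.0ℤ ℤ.<_) (ℤ.*-identityʳ z) (drop-*<* 0<z))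
    (λ 0<z → *<* (subst (ℤ.0ℤ ℤ.<_) (sym (ℤ.*-identityʳ z)) 0<z))

  0<c*q⇔0<q : ∀ c .{{_ : Positive c}} q → 0ℚ < c * q ⇔ 0ℚ < q
  0<c*q⇔0<q c q = mk⇔
    (λ 0<cq → *-cancelˡ-<-nonNeg c {{pos⇒nonNeg c}} (subst (_< c * q) (sym (*-zeroʳ c)) 0<cq))
    (λ 0<q → subst (_< c * q) (*-zeroʳ c) (*-monoʳ-<-pos c 0<q))

  val≡ι∘valℤ : ∀ b → val b ≡ ι (valℤ b)
  val≡ι∘valℤ true  = refl
  val≡ι∘valℤ false = refl

  sign-cong : ∀ {q r} → 0ℚ < q ⇔ 0ℚ < r → sign q ≡ sign r
  sign-cong {q} {r} q⇔r = cong (λ b → if b then 1 else 0) (does-⇔ q⇔r (0ℚ <? q) (0ℚ <? r))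

  sign≡atLeast : ∀ {q a t} → 0ℚ < q ⇔ a ℕ.≤ t → sign q ≡ atLeast a t
  sign≡atLeast {q} {a} {t} q⇔a≤t = cong (λ b → if b then 1 else 0) (does-⇔ q⇔a≤t (0ℚ <? q) (a ℕ.≤? t))

  sumℚ-++ : ∀ xs ys → sumℚ (xs ++ ys) ≡ sumℚ xs + sumℚ ys
  sumℚ-++ []       ys = sym (+-identityˡ (sumℚ ys))
  sumℚ-++ (x ∷ xs) ys = trans (cong (_+_ x) (sumℚ-++ xs ys)) (sym (+-assoc x (sumℚ xs) (sumℚ ys)))

  sumℚ-allPoints : ∀ m (G : Cube m → ℤ) → sumℚ (map (λ y → ι (G y)) (allPoints m)) ≡ ι (sumCube m G)
  sumℚ-allPoints zero    G = +-identityʳ (ι (G (λ ())))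
  sumℚ-allPoints (suc m) G = begin
    sumℚ (map F (Pᵗ ++ (Pᶠ ++ [])))                      ≡⟨ cong (λ l → sumℚ (map F (Pᵗ ++ l))) (List.++-identityʳ Pᶠ) ⟩
    sumℚ (map F (Pᵗ ++ Pᶠ))                              ≡⟨ cong sumℚ (List.map-++ F Pᵗ Pᶠ) ⟩
    sumℚ (map F Pᵗ ++ map F Pᶠ)                          ≡⟨ sumℚ-++ (map F Pᵗ) (map F Pᶠ) ⟩
    sumℚ (map F Pᵗ) + sumℚ (map F Pᶠ)                    ≡⟨ cong₂ _+_ (cong sumℚ (sym (List.map-∘ P))) (cong sumℚ (sym (List.map-∘ P))) ⟩
    sumℚ (map (λ z → ι (G (true ∷ᵛ z))) P) + sumℚ (map (λ z → ι (G (false ∷ᵛ z))) P)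
      ≡⟨ cong₂ _+_ (sumℚ-allPoints m (λ z → G (true ∷ᵛ z))) (sumℚ-allPoints m (λ z → G (false ∷ᵛ z))) ⟩
    ι (sumCube m (λ z → G (true ∷ᵛ z))) + ι (sumCube m (λ z → G (false ∷ᵛ z)))
      ≡⟨ sym (ι-+ (sumCube m (λ z → G (true ∷ᵛ z))) (sumCube m (λ z → G (false ∷ᵛ z)))) ⟩
    ι (sumCube (suc m) G)                                ∎
    where
    open ≡-Reasoning
    F : Cube (suc m) → ℚ
    F y = ι (G y)
    P = allPoints m
    Pᵗ = map (true ∷ᵛ_) P
    Pᶠ = map (false ∷ᵛ_) P

  sumFin-ι : ∀ n (g : Fin n → ℤ) → sumFin n (λ i → ι (g i)) ≡ ι (sum g)
  sumFin-ι zero    g = refl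
  sumFin-ι (suc n) g = trans (cong (_+_ (ι (g zero))) (sumFin-ι n (λ i → g (suc i)))) (sym (ι-+ (g zero) _))

  sumFin-cong : ∀ n {f g : Fin n → ℚ} → (∀ i → f i ≡ g i) → sumFin n f ≡ sumFin n g
  sumFin-cong zero    f≗g = refl
  sumFin-cong (suc n) f≗g = cong₂ _+_ (f≗g zero) (sumFin-cong n (λ i → f≗g (suc i)))

  sumFin-*ˡ : ∀ n c (f : Fin n → ℚ) → sumFin n (λ i → c * f i) ≡ c * sumFin n f
  sumFin-*ˡ zero    c f = sym (*-zeroʳ c)
  sumFin-*ˡ (suc n) c f =
    trans (cong (_+_ (c * f zero)) (sumFin-*ˡ n c (λ i → f (suc i)))) (sym (*-distribˡ-+ c (f zero) _))

  2⁻ᵏ : ℕ → ℚ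
  2⁻ᵏ k = ((+ 1) / (2 ^ k)) {{ℕ.m^n≢0 2 k}}

  2⁻ᵏ-positive : ∀ k → Positive (2⁻ᵏ k)
  2⁻ᵏ-positive k = normalize-pos 1 (2 ^ k) {{ℕ.m^n≢0 2 k}}

  fourier1≡ : ∀ k (f : Cube k → ℕ) i → fourier1 k f i ≡ 2⁻ᵏ k * ι (sumCube k (λ y → + f y ℤ.* valℤ (y i)))
  fourier1≡ k f i = cong (2⁻ᵏ k *_) (trans
    (cong sumℚ (List.map-cong (λ y → trans (cong (ι (+ f y) *_) (val≡ι∘valℤ (y i))) (sym (ι-* (+ f y) (valℤ (y i)))))
                              (allPoints k)))
    (sumℚ-allPoints k (λ y → + f y ℤ.* valℤ (y i))))

  fourier-sum≡ : ∀ k (f : Cube k → ℕ) (x : Cube k) →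
    sumFin k (λ i → fourier1 k f i * val (x i)) ≡
    2⁻ᵏ k * ι (sum (λ i → sumCube k (λ y → + f y ℤ.* valℤ (y i)) ℤ.* valℤ (x i)))
  fourier-sum≡ k f x = begin
    sumFin k (λ i → fourier1 k f i * val (x i))
      ≡⟨ sumFin-cong k (λ i → begin
           fourier1 k f i * val (x i)                 ≡⟨ cong₂ _*_ (fourier1≡ k f i) (val≡ι∘valℤ (x i)) ⟩
           2⁻ᵏ k * ι (E i) * ι (valℤ (x i))           ≡⟨ *-assoc (2⁻ᵏ k) (ι (E i)) (ι (valℤ (x i))) ⟩
           2⁻ᵏ k * (ι (E i) * ι (valℤ (x i)))         ≡⟨ cong (2⁻ᵏ k *_) (sym (ι-* (E i) (valℤ (x i)))) ⟩
           2⁻ᵏ k * ι (E i ℤ.* valℤ (x i))             ∎) ⟩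
    sumFin k (λ i → 2⁻ᵏ k * ι (E i ℤ.* valℤ (x i)))  ≡⟨ sumFin-*ˡ k (2⁻ᵏ k) _ ⟩
    2⁻ᵏ k * sumFin k (λ i → ι (E i ℤ.* valℤ (x i)))  ≡⟨ cong (2⁻ᵏ k *_) (sumFin-ι k (λ i → E i ℤ.* valℤ (x i))) ⟩
    2⁻ᵏ k * ι (sum (λ i → E i ℤ.* valℤ (x i)))       ∎
    where
    open ≡-Reasoning
    E : Fin k → ℤ
    E i = sumCube k (λ y → + f y ℤ.* valℤ (y i))

  WMON≡sign-ι : ∀ n j (y : Cube (suc n)) →
    WMON (suc n) j y ≡ sign (ι (+ j ℤ.* valℤ (y zero) ℤ.+ sum (λ i → valℤ (y (suc i)))))
  WMON≡sign-ι n j y = cong sign (begin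
    ι (+ j) * val (y zero) + sumFin n (λ i → val (y (suc i)))
      ≡⟨ cong₂ _+_ (cong (ι (+ j) *_) (val≡ι∘valℤ (y zero))) (sumFin-cong n (λ i → val≡ι∘valℤ (y (suc i)))) ⟩
    ι (+ j) * ι (valℤ (y zero)) + sumFin n (λ i → ι (valℤ (y (suc i))))
      ≡⟨ cong₂ _+_ (sym (ι-* (+ j) (valℤ (y zero)))) (sumFin-ι n (λ i → valℤ (y (suc i)))) ⟩
    ι (+ j ℤ.* valℤ (y zero)) + ι (sum (λ i → valℤ (y (suc i))))
      ≡⟨ sym (ι-+ (+ j ℤ.* valℤ (y zero)) (sum (λ i → valℤ (y (suc i))))) ⟩
    ι (+ j ℤ.* valℤ (y zero) ℤ.+ sum (λ i → valℤ (y (suc i))))  ∎)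
    where open ≡-Reasoning

open import Data.Nat using (ℕ; zero; suc; _≤_; _<_; _*_; _+_; _^_; s≤s; z≤n)
open import Data.Nat.Properties
open import Data.Nat.Combinatorics using (_C_)
open import Data.Nat.Divisibility using (_∣_; divides; ∣m+n∣m⇒∣n)
import Data.Nat.Tactic.RingSolver as ℕ-Solver
open import Data.Integer as ℤ using (ℤ; +_; 0ℤ; 1ℤ; -1ℤ)
import Data.Integer.Properties as ℤ
open import Data.Integer.Tactic.RingSolver using (solve-∀)
open import Algebra.Properties.Semiring.Sum ℤ.+-*-semiring using (sum; *-distribˡ-sum; sum-cong-≗)
open import Data.Rational using (0ℚ) renaming (_*_ to _*ℚ_; _<_ to _<ℚ_)
open import Data.Bool using (Bool; true; false)
open import Data.Fin using (Fin; zero; suc)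
open import Data.Vec.Functional using (tail) renaming (_∷_ to _∷ᵛ_)
open import Data.Product using (Σ-syntax; _×_; _,_; proj₁; proj₂)
open import Function.Bundles using (_⇔_)
open import Function.Properties.Equivalence using () renaming (trans to ⇔-trans; sym to ⇔-sym)
open import Relation.Binary.PropositionalEquality
open Binomial
open CubeSums
open RationalSigns

module WeightedMajority (p j : ℕ) (1≤j : 1 ≤ j) (power : j * (p + j) ^ j < suc j * suc p ^ j) where

  open CentralBinomials p j

  n k : ℕ
  n = suc m
  k = suc n

  W : Cube k → ℕ
  W = WMON k j

  cut : Bool → ℕ
  cut true  = p
  cut false = j + p

  linear-form : ∀ (y : Cube k) → let t = weight (tail y) in
    + j ℤ.* valℤ (y zero) ℤ.+ sum (λ i → valℤ (y (suc i))) ≡ + (2 * t) ℤ.- + suc (2 * cut (y zero))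
  linear-form y = begin
    + j ℤ.* valℤ (y zero) ℤ.+ S                 ≡⟨ cong (ℤ._+_ (+ j ℤ.* valℤ (y zero))) S≡T-n ⟩
    + j ℤ.* valℤ (y zero) ℤ.+ (T ℤ.- + n)       ≡⟨ shape (y zero) ⟩
    T ℤ.- + suc (2 * cut (y zero))              ∎
    where
    open ≡-Reasoning
    -- The identities in shape match the goal only up to the definitional equations
    -- + a ℤ.+ + b = + (a + b) and 2 * a = a + (a + 0).
    S T : ℤ
    S = sum (λ i → valℤ (y (suc i)))
    T = + (2 * weight (tail y))
    s≡s+n-n : ∀ s n → s ≡ s ℤ.+ n ℤ.- n
    s≡s+n-n = solve-∀
    S≡T-n : S ≡ T ℤ.- + n
    S≡T-n = trans (s≡s+n-n S (+ n)) (cong (ℤ._- + n) (sum-valℤ+m≡2*weight n (tail y)))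
    shape : ∀ v → + j ℤ.* valℤ v ℤ.+ (T ℤ.- + n) ≡ T ℤ.- + suc (2 * cut v)
    shape true  = identity (+ j) (+ p) T
      where
      identity : ∀ J P T → J ℤ.* 1ℤ ℤ.+ (T ℤ.- (1ℤ ℤ.+ P ℤ.+ P ℤ.+ J)) ≡ T ℤ.- (1ℤ ℤ.+ (P ℤ.+ (P ℤ.+ 0ℤ)))
      identity = solve-∀
    shape false = identity (+ j) (+ p) T
      where
      identity : ∀ J P T → J ℤ.* -1ℤ ℤ.+ (T ℤ.- (1ℤ ℤ.+ P ℤ.+ P ℤ.+ J))
                           ≡ T ℤ.- (1ℤ ℤ.+ ((J ℤ.+ P) ℤ.+ ((J ℤ.+ P) ℤ.+ 0ℤ)))
      identity = solve-∀

  W≡atLeast : ∀ y → W y ≡ atLeast (suc (cut (y zero))) (weight (tail y))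
  W≡atLeast y = trans (WMON≡sign-ι n j y) (sign≡atLeast (⇔-trans (0<ι⇔0< _)
    (subst (λ w → 0ℤ ℤ.< w ⇔ suc (cut (y zero)) ≤ weight (tail y)) (sym (linear-form y))
           (0<[2t]-[1+2a]⇔1+a≤t (weight (tail y)) (cut (y zero))))))

  E : Fin k → ℤ
  E i = sumCube k (λ y → + W y ℤ.* valℤ (y i))

  S₀ S₁ : ℕ
  S₀ = sumBelow j (λ e → m C (e + p))
  S₁ = sumBelow j (λ e → m C (e + suc p))

  E-zero : E zero ≡ + (S₀ + S₁)
  E-zero = begin
    sumCube n (λ z → + W (true ∷ᵛ z) ℤ.* 1ℤ) ℤ.+ sumCube n (λ z → + W (false ∷ᵛ z) ℤ.* -1ℤ)
      ≡⟨ cong₂ ℤ._+_ (branch true 1ℤ) (branch false -1ℤ) ⟩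
    + binomialTail n (suc p) ℤ.* 1ℤ ℤ.+ + binomialTail n (suc (j + p)) ℤ.* -1ℤ
      ≡⟨ cong (λ x → + x ℤ.* 1ℤ ℤ.+ + (R + R′) ℤ.* -1ℤ) (cong₂ _+_ tail₀ tail₁) ⟩
    + ((S₀ + R) + (S₁ + R′)) ℤ.* 1ℤ ℤ.+ + (R + R′) ℤ.* -1ℤ
      ≡⟨ cancel (+ S₀) (+ S₁) (+ R) (+ R′) ⟩
    + (S₀ + S₁)
      ∎
    where
    open ≡-Reasoning
    R R′ : ℕ
    R  = binomialTail m (j + p)
    R′ = binomialTail m (suc (j + p))
    branch : ∀ v c → sumCube n (λ z → + W (v ∷ᵛ z) ℤ.* c) ≡ + binomialTail n (suc (cut v)) ℤ.* c
    branch v c = begin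
      sumCube n (λ z → + W (v ∷ᵛ z) ℤ.* c)
        ≡⟨ sumCube-cong n (λ z → cong (λ w → + w ℤ.* c) (W≡atLeast (v ∷ᵛ z))) ⟩
      sumCube n (λ z → + atLeast (suc (cut v)) (weight z) ℤ.* c)
        ≡⟨ sumCube-*ʳ n (λ z → + atLeast (suc (cut v)) (weight z)) c ⟩
      sumCube n (λ z → + atLeast (suc (cut v)) (weight z)) ℤ.* c
        ≡⟨ cong (ℤ._* c) (sumCube-atLeast n (suc (cut v))) ⟩
      + binomialTail n (suc (cut v)) ℤ.* c
        ∎
    tail₀ : binomialTail m p ≡ S₀ + R
    tail₀ = binomialTail≡window+binomialTail m p j
    tail₁ : binomialTail m (suc p) ≡ S₁ + R′
    tail₁ = trans (binomialTail≡window+binomialTail m (suc p) j) (cong (λ r → S₁ + binomialTail m r) (+-suc j p))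
    cancel : ∀ a b r r′ → ((a ℤ.+ r) ℤ.+ (b ℤ.+ r′)) ℤ.* 1ℤ ℤ.+ (r ℤ.+ r′) ℤ.* -1ℤ ≡ a ℤ.+ b
    cancel = solve-∀

  E-suc : ∀ i → E (suc i) ≡ + (β + β)
  E-suc i = begin
    sumCube n (λ z → + W (true ∷ᵛ z) ℤ.* valℤ (z i)) ℤ.+ sumCube n (λ z → + W (false ∷ᵛ z) ℤ.* valℤ (z i))
      ≡⟨ cong₂ ℤ._+_ (branch true) (branch false) ⟩
    + (m C p) ℤ.+ + (m C (j + p))
      ≡⟨ cong (λ c → + (m C p + c)) mC[j+p]≡β ⟩
    + (β + β)
      ∎
    where
    open ≡-Reasoning
    branch : ∀ v → sumCube n (λ z → + W (v ∷ᵛ z) ℤ.* valℤ (z i)) ≡ + (m C cut v)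
    branch v = trans (sumCube-cong n (λ z → cong (λ w → + w ℤ.* valℤ (z i)) (W≡atLeast (v ∷ᵛ z))))
                     (sumCube-atLeast-*-coordinate m (cut v) i)

  fourier-integer : ∀ (x : Cube k) →
    sum (λ i → E i ℤ.* valℤ (x i)) ≡ + (S₀ + S₁) ℤ.* valℤ (x zero) ℤ.+ + (β + β) ℤ.* sum (λ i → valℤ (x (suc i)))
  fourier-integer x = cong₂ ℤ._+_ (cong (ℤ._* valℤ (x zero)) E-zero)
    (trans (sum-cong-≗ (λ i → cong (ℤ._* valℤ (x (suc i))) (E-suc i)))
           (sym (*-distribˡ-sum (+ (β + β)) (λ i → valℤ (x (suc i))))))

  windows-close : j * (β + β) < (S₀ + S₁) + (β + β) × (S₀ + S₁) < j * (β + β) + (β + β)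
  windows-close = lower , upper
    where
    w₀ = window-bounds 1≤j power p ≤-refl (n≤1+n p)
    w₁ = window-bounds 1≤j power (suc p) (n≤1+n p) ≤-refl
    lower : j * (β + β) < (S₀ + S₁) + (β + β)
    lower = subst₂ _<_ (sym (*-distribˡ-+ j β β)) (regroup S₀ β S₁ β)
              (<-trans (+-monoʳ-< (j * β) (proj₁ w₁)) (+-monoˡ-< (S₁ + β) (proj₁ w₀)))
      where
      regroup : ∀ a b c d → (a + b) + (c + d) ≡ (a + c) + (b + d)
      regroup = ℕ-Solver.solve-∀
    upper : (S₀ + S₁) < j * (β + β) + (β + β)
    upper = subst (S₀ + S₁ <_) (regroup j β) (+-mono-< (proj₂ w₀) (proj₂ w₁))
      where
      regroup : ∀ j β → (j * β + β) + (j * β + β) ≡ j * (β + β) + (β + β)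
      regroup = ℕ-Solver.solve-∀

  -- Stated for any k′ ≡ k because rewriting k in a caller's goal makes Agda unfold sumFin and fourier1.
  WMON≡sign-fourier : ∀ {k′} → k′ ≡ k → (x : Cube k′) →
                      WMON k′ j x ≡ sign (sumFin k′ (λ i → fourier1 k′ (WMON k′ j) i *ℚ val (x i)))
  WMON≡sign-fourier refl x = begin
    W x                                   ≡⟨ WMON≡sign-ι n j x ⟩
    sign (ι w)                            ≡⟨ sign-cong same-sign ⟩
    sign (2⁻ᵏ k *ℚ ι Z)                   ≡⟨ cong sign (sym (fourier-sum≡ k W x)) ⟩
    sign (sumFin k (λ i → fourier1 k W i *ℚ val (x i)))  ∎
    where
    open ≡-Reasoning
    v = x zero
    S = sum (λ i → valℤ (x (suc i)))
    w = + j ℤ.* valℤ v ℤ.+ S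
    Z = sum (λ i → E i ℤ.* valℤ (x i))
    w≢0 : w ≢ 0ℤ
    w≢0 = subst (_≢ 0ℤ) (sym (linear-form x)) ([2t]-[1+2a]≢0 (weight (tail x)) (cut v))
    perturbed : 0ℤ ℤ.< w ⇔ 0ℤ ℤ.< Z
    perturbed = subst (λ z → 0ℤ ℤ.< w ⇔ 0ℤ ℤ.< z) (sym (fourier-integer x))
      (⇔-sym (linear-sign-stable (β + β) (S₀ + S₁) j v S (proj₁ windows-close) (proj₂ windows-close) w≢0))
    same-sign : 0ℚ <ℚ ι w ⇔ 0ℚ <ℚ 2⁻ᵏ k *ℚ ι Z
    same-sign = ⇔-trans (0<ι⇔0< w) (⇔-trans perturbed
      (⇔-trans (⇔-sym (0<ι⇔0< Z)) (⇔-sym (0<c*q⇔0<q (2⁻ᵏ k) {{2⁻ᵏ-positive k}} (ι Z)))))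

2+j≤7j³ : ∀ j → 2 ≤ j → 2 + j ≤ 7 * j ^ 3
2+j≤7j³ (suc (suc c)) (s≤s (s≤s z≤n)) = subst (4 + c ≤_) (expand c) (m≤m+n (4 + c) _)
  where
  expand : ∀ c → (4 + c) + (7 * c * c * c + 42 * c * c + 83 * c + 52) ≡ 7 * ((2 + c) * ((2 + c) * ((2 + c) * 1)))
  expand = ℕ-Solver.solve-∀

k≡2+p+p+j : ∀ j k → 2 + j ≤ k → 2 ∣ k + j → Σ[ p ∈ ℕ ] k ≡ suc (suc (p + p + j))
k≡2+p+p+j j k 2+j≤k 2∣k+j with m≤n⇒∃[o]m+o≡n 2+j≤k
... | e , refl with ∣m+n∣m⇒∣n (subst (2 ∣_) (reorder j e) 2∣k+j) (divides (suc j) (double j))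
  where
  reorder : ∀ j e → 2 + j + e + j ≡ 2 + j + j + e
  reorder = ℕ-Solver.solve-∀
  double : ∀ j → 2 + j + j ≡ (1 + j) * 2
  double = ℕ-Solver.solve-∀
... | divides p refl = p , shape j p
  where
  shape : ∀ j p → 2 + j + p * 2 ≡ 2 + (p + p + j)
  shape = ℕ-Solver.solve-∀

power-inequality : ∀ j p → 2 ≤ j → 7 * j ^ 3 ≤ suc (suc (p + p + j)) → j * (p + j) ^ j < suc j * suc p ^ j
power-inequality j@(suc (suc c)) p (s≤s (s≤s z≤n)) 7j³≤k =
  subst (λ a → j * a ^ j < suc j * suc p ^ j) (sym (+-suc p (suc c)))
        (w*[b+e]^[1+n]<[1+w]*b^[1+n] j (suc p) (suc c) (suc c) small)
  where
  open ≤-Reasoning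
  X : ℕ
  X = suc j * j * suc c
  expand : ∀ c → 2 * (1 + (3 + c) * (2 + c) * (1 + c)) + (5 * c * c * c + 30 * c * c + 63 * c + 42)
                 ≡ 7 * ((2 + c) * ((2 + c) * ((2 + c) * 1))) + c
  expand = ℕ-Solver.solve-∀
  double : ∀ p c → 2 + (p + p + (2 + c)) + c ≡ 2 * (1 + p + (1 + c))
  double = ℕ-Solver.solve-∀
  small : X < suc p + suc c
  small = *-cancelˡ-≤ 2 (begin
    2 * suc X                   ≤⟨ m≤m+n (2 * suc X) _ ⟩
    2 * suc X + _               ≡⟨ expand c ⟩
    7 * j ^ 3 + c               ≤⟨ +-monoˡ-≤ c 7j³≤k ⟩
    suc (suc (p + p + j)) + c   ≡⟨ double p c ⟩
    2 * (suc p + suc c)         ∎)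

lemma5p9 : (j k : ℕ) → 2 ≤ j → 7 * j ^ 3 ≤ k → 2 ∣ (k + j) →
    (x : Cube k) →
    WMON k j x ≡ sign (sumFin k (λ i → fourier1 k (WMON k j) i *ℚ val (x i)))
lemma5p9 j k 2≤j 7j³≤k 2∣k+j = from-decomposition (k≡2+p+p+j j k (≤-trans (2+j≤7j³ j 2≤j) 7j³≤k) 2∣k+j)
  where
  from-decomposition : Σ[ p ∈ ℕ ] k ≡ suc (suc (p + p + j)) →
    (x : Cube k) → WMON k j x ≡ sign (sumFin k (λ i → fourier1 k (WMON k j) i *ℚ val (x i)))
  from-decomposition (p , k≡) = WeightedMajority.WMON≡sign-fourier p j (<⇒≤ 2≤j)
    (power-inequality j p 2≤j (subst (7 * j ^ 3 ≤_) k≡ 7j³≤k)) k≡
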